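{- Let $R$ be a commutative ring with $1$ and let $\mathbf r=(r_0,r_1,r_2,\ldots)$ be any sequence of elements of $R$. Define $C^{(\mathbf r)}(n,k)$ and $C^{(\mathbf r)}(n)$ as in the context. Then for every positive integer $n$, \[C^{(\mathbf r)}(n)=\sum_{i=0}^{n-1}r_{i}\,C^{(\mathbf r)}(n-i-1).\]
   Context: For nonnegative integers $n,k$ with $k\le n$, the elements $C^{(\mathbf r)}(n,k)\in R$ are defined by: $C^{(\mathbf r)}(0,0)=1$; $C^{(\mathbf r)}(n,0)=0$ for $n>0$; $C^{(\mathbf r)}(n,k)=0$ for $0<n<k$; $C^{(\mathbf r)}(n,1)=r_{n-1}$ for $n\ge 1$; and for $1<k\le n$, \[C^{(\mathbf r)}(n,k)=\sum_{i=0}^{n-k}r_{i}\,C^{(\mathbf r)}(n-i-1,k-1).\] Further, $C^{(\mathbf r)}(0)=1$ and $C^{(\mathbf r)}(n)=\sum_{k=1}^{n}C^{(\mathbf r)}(n,k)$ for $n\ge 1$. -}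

module Defs where

open import Level using (Level)
open import Algebra.Bundles using (CommutativeRing)
open import Data.Nat using (ℕ; zero; suc; _∸_; _<ᵇ_)
open import Data.Bool using (if_then_else_)

module CNumbers {c ℓ : Level} (R : CommutativeRing c ℓ) where
  open CommutativeRing R

  ∑< : ℕ → (ℕ → Carrier) → Carrier
  ∑< zero    f = 0#
  ∑< (suc m) f = ∑< m f + f m

  ∑1to : ℕ → (ℕ → Carrier) → Carrier
  ∑1to zero    f = 0#
  ∑1to (suc n) f = ∑1to n f + f (suc n)

  Cnk : (ℕ → Carrier) → ℕ → ℕ → Carrier
  Cnk r n zero with n
  ... | zero  = 1#
  ... | suc _ = 0#
  Cnk r n (suc zero) with n
  ... | zero  = 0#
  ... | suc m = r m
  Cnk r n (suc (suc k)) =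
    if n <ᵇ suc (suc k)
    then 0#                                     -- n < k  (covers 0 < n < k and n = 0)
    else ∑< (suc (n ∸ suc (suc k)))
            (λ i → r i * Cnk r (n ∸ i ∸ 1) (suc k))

  Cn : (ℕ → Carrier) → ℕ → Carrier
  Cn r zero    = 1#
  Cn r (suc n) = ∑1to (suc n) (λ k → Cnk r (suc n) k)

-- Extending the inner sum of the recurrence to the full range i < n, and the
-- k = 1 clause into the same shape via C(m, 0) = [m = 0], gives the uniform
-- recurrence C(n, k + 1) = ∑_{i<n} r_i C(n - i - 1, k) for every k.  Summing
-- it over k and interchanging the two sums yields the theorem, because
-- C(m, k) = 0 for m < k lets every row sum C(m) be taken over k < n.
module Submission where

open import Defs
open import Level using (Level)
open import Algebra.Bundles using (CommutativeRing)
open import Data.Nat using (ℕ; zero; suc; _∸_; _≤_; _<_; z≤n; s≤s; _<ᵇ_) renaming (_+_ to _+ℕ_)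
open import Data.Nat.Properties
  using (≤-refl; ≤-trans; +-comm; m<n⇒m<1+n; m≤n⇒m<n∨m≡n; m∸n≤m; ∸-monoˡ-≤; m≤n+o⇒m∸n≤o; <ᵇ⇒<; <⇒<ᵇ; ≤-pred)
open import Data.Bool using (true; false; T)
open import Data.Sum using (inj₁; inj₂)
import Relation.Binary.PropositionalEquality as ≡
import Algebra.Properties.CommutativeSemigroup as CommutativeSemigroupProperties
import Relation.Binary.Reasoning.Setoid as SetoidReasoning

m∸n≤o⇒m≤n+o : ∀ m n o → m ∸ n ≤ o → m ≤ n +ℕ o
m∸n≤o⇒m≤n+o zero    n       o _  = z≤n
m∸n≤o⇒m≤n+o (suc m) zero    o le = le
m∸n≤o⇒m≤n+o (suc m) (suc n) o le = s≤s (m∸n≤o⇒m≤n+o m n o le)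

m∸n≤o⇒m∸o≤n : ∀ m n o → m ∸ n ≤ o → m ∸ o ≤ n
m∸n≤o⇒m∸o≤n m n o le = m≤n+o⇒m∸n≤o m o (≡.subst (m ≤_) (+-comm n o) (m∸n≤o⇒m≤n+o m n o le))

module ∑<-Properties {c ℓ : Level} (R : CommutativeRing c ℓ) where
  open CommutativeRing R
  open CNumbers R
  open CommutativeSemigroupProperties +-commutativeSemigroup using (interchange)
  open SetoidReasoning setoid

  ∑<-cong : ∀ m {f g : ℕ → Carrier} → (∀ i → i < m → f i ≈ g i) → ∑< m f ≈ ∑< m g
  ∑<-cong zero    f≈g = refl
  ∑<-cong (suc m) f≈g = +-cong (∑<-cong m (λ i i<m → f≈g i (m<n⇒m<1+n i<m))) (f≈g m ≤-refl)

  ∑<-extend-by-zeros : ∀ {a b} {f : ℕ → Carrier} → a ≤ b →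
                       (∀ i → a ≤ i → i < b → f i ≈ 0#) → ∑< b f ≈ ∑< a f
  ∑<-extend-by-zeros {b = zero}  z≤n  _ = refl
  ∑<-extend-by-zeros {a} {suc b} {f} a≤b fᵢ≈0 with m≤n⇒m<n∨m≡n a≤b
  ... | inj₂ ≡.refl    = refl
  ... | inj₁ (s≤s a≤b) = begin
    ∑< b f + f b ≈⟨ +-cong (∑<-extend-by-zeros a≤b (λ i a≤i i<b → fᵢ≈0 i a≤i (m<n⇒m<1+n i<b)))
                         (fᵢ≈0 b a≤b ≤-refl) ⟩
    ∑< a f + 0#  ≈⟨ +-identityʳ _ ⟩
    ∑< a f       ∎

  ∑<-zero : ∀ m {f : ℕ → Carrier} → (∀ i → i < m → f i ≈ 0#) → ∑< m f ≈ 0#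
  ∑<-zero m fᵢ≈0 = ∑<-extend-by-zeros z≤n (λ i _ → fᵢ≈0 i)

  ∑<-suc-head : ∀ m (f : ℕ → Carrier) → ∑< (suc m) f ≈ f 0 + ∑< m (λ i → f (suc i))
  ∑<-suc-head zero    f = trans (+-identityˡ _) (sym (+-identityʳ _))
  ∑<-suc-head (suc m) f = trans (+-congʳ (∑<-suc-head m f)) (+-assoc _ _ _)

  ∑<-distrib-+ : ∀ m (f g : ℕ → Carrier) → ∑< m (λ i → f i + g i) ≈ ∑< m f + ∑< m g
  ∑<-distrib-+ zero    f g = sym (+-identityʳ _)
  ∑<-distrib-+ (suc m) f g = trans (+-congʳ (∑<-distrib-+ m f g)) (interchange _ _ _ _)

  ∑<-comm : ∀ a b (f : ℕ → ℕ → Carrier) →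
            ∑< a (λ i → ∑< b (f i)) ≈ ∑< b (λ j → ∑< a (λ i → f i j))
  ∑<-comm a zero    f = ∑<-zero a (λ _ _ → refl)
  ∑<-comm a (suc b) f = trans (∑<-distrib-+ a (λ i → ∑< b (f i)) (λ i → f i b))
                              (+-congʳ (∑<-comm a b f))

  *-distribˡ-∑< : ∀ x m (f : ℕ → Carrier) → x * ∑< m f ≈ ∑< m (λ i → x * f i)
  *-distribˡ-∑< x zero    f = zeroʳ x
  *-distribˡ-∑< x (suc m) f = trans (distribˡ x _ _) (+-congʳ (*-distribˡ-∑< x m f))

  ∑1to≈∑< : ∀ m (f : ℕ → Carrier) → ∑1to m f ≈ ∑< m (λ i → f (suc i))
  ∑1to≈∑< zero    f = refl
  ∑1to≈∑< (suc m) f = +-congʳ (∑1to≈∑< m f)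

module CnkProperties {c ℓ : Level} (R : CommutativeRing c ℓ) (r : ℕ → CommutativeRing.Carrier R) where
  open CommutativeRing R
  open CNumbers R
  open ∑<-Properties R
  open SetoidReasoning setoid

  m<k⇒Cnk≈0 : ∀ {m k} → m < k → Cnk r m k ≈ 0#
  m<k⇒Cnk≈0 {zero}  {suc zero}    _ = refl
  m<k⇒Cnk≈0 {suc m} {suc zero}    (s≤s ())
  m<k⇒Cnk≈0 {m}     {suc (suc k)} m<k with m <ᵇ suc (suc k) | <⇒<ᵇ m<k
  ... | true | _ = refl

  Cnk-suc : ∀ n j → Cnk r n (suc j) ≈ ∑< n (λ i → r i * Cnk r (n ∸ i ∸ 1) j)
  Cnk-suc zero    zero    = refl
  Cnk-suc zero    (suc k) = refl
  Cnk-suc (suc m) zero    = sym (begin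
    ∑< m (λ i → r i * Cnk r (suc m ∸ i ∸ 1) 0) + r m * Cnk r (suc m ∸ m ∸ 1) 0
      ≈⟨ +-cong (∑<-zero m (λ i i<m → trans (*-congˡ (Cₘ₋ᵢ,₀≈0 i<m)) (zeroʳ _)))
                (*-congˡ (C₀,₀≈1 m)) ⟩
    0# + r m * 1# ≈⟨ +-identityˡ _ ⟩
    r m * 1#      ≈⟨ *-identityʳ _ ⟩
    r m           ∎)
    where
    Cₘ₋ᵢ,₀≈0 : ∀ {m i} → i < m → Cnk r (suc m ∸ i ∸ 1) 0 ≈ 0#
    Cₘ₋ᵢ,₀≈0 {suc m} {zero}  _         = refl
    Cₘ₋ᵢ,₀≈0 {suc m} {suc i} (s≤s i<m) = Cₘ₋ᵢ,₀≈0 i<m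

    C₀,₀≈1 : ∀ m → Cnk r (suc m ∸ m ∸ 1) 0 ≈ 1#
    C₀,₀≈1 zero    = refl
    C₀,₀≈1 (suc m) = C₀,₀≈1 m
  Cnk-suc (suc n) (suc k) with suc n <ᵇ suc (suc k) in n<ᵇk
  ... | true  = sym (∑<-zero (suc n) (λ i _ → vanishing-term (row≤k i)))
    where
    n≤k : n ≤ k
    n≤k = ≤-pred (≤-pred (<ᵇ⇒< (suc n) (suc (suc k)) (≡.subst T (≡.sym n<ᵇk) _)))

    row≤k : ∀ i → suc n ∸ i ∸ 1 ≤ k
    row≤k i = ≤-trans (∸-monoˡ-≤ 1 (m∸n≤m (suc n) i)) n≤k

    vanishing-term : ∀ {i} → suc n ∸ i ∸ 1 ≤ k → r i * Cnk r (suc n ∸ i ∸ 1) (suc k) ≈ 0#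
    vanishing-term le = trans (*-congˡ (m<k⇒Cnk≈0 (s≤s le))) (zeroʳ _)
  ... | false = sym (∑<-extend-by-zeros (s≤s (m∸n≤m n (suc k))) vanishing-term)
    where
    vanishing-term : ∀ i → suc (n ∸ suc k) ≤ i → i < suc n →
                     r i * Cnk r (suc n ∸ i ∸ 1) (suc k) ≈ 0#
    vanishing-term (suc i) (s≤s n∸[1+k]≤i) _ =
      trans (*-congˡ (m<k⇒Cnk≈0 (s≤s (∸-monoˡ-≤ 1 (m∸n≤o⇒m∸o≤n n (suc k) i n∸[1+k]≤i)))))
            (zeroʳ _)

  ∑<Cnk≈Cn : ∀ {m M} → m < M → ∑< M (Cnk r m) ≈ Cn r m
  ∑<Cnk≈Cn {zero} {suc M} _ = begin
    ∑< (suc M) (Cnk r 0)               ≈⟨ ∑<-suc-head M (Cnk r 0) ⟩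
    1# + ∑< M (λ k → Cnk r 0 (suc k))  ≈⟨ +-congˡ (∑<-zero M (λ k _ → m<k⇒Cnk≈0 {k = suc k} (s≤s z≤n))) ⟩
    1# + 0#                            ≈⟨ +-identityʳ _ ⟩
    1#                                 ∎
  ∑<Cnk≈Cn {suc m} {suc M} (s≤s m<M) = begin
    ∑< (suc M) (Cnk r (suc m))                  ≈⟨ ∑<-suc-head M (Cnk r (suc m)) ⟩
    0# + ∑< M (λ k → Cnk r (suc m) (suc k))     ≈⟨ +-identityˡ _ ⟩
    ∑< M (λ k → Cnk r (suc m) (suc k))          ≈⟨ ∑<-extend-by-zeros m<M (λ _ m<k _ → m<k⇒Cnk≈0 (s≤s m<k)) ⟩
    ∑< (suc m) (λ k → Cnk r (suc m) (suc k))    ≈⟨ sym (∑1to≈∑< (suc m) (Cnk r (suc m))) ⟩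
    Cn r (suc m)                                ∎

  Cn-recurrence : ∀ n → let N = suc n in Cn r N ≈ ∑< N (λ i → r i * Cn r (N ∸ i ∸ 1))
  Cn-recurrence n = begin
    Cn r N                                                  ≈⟨ ∑1to≈∑< N (Cnk r N) ⟩
    ∑< N (λ k → Cnk r N (suc k))                            ≈⟨ ∑<-cong N (λ k _ → Cnk-suc N k) ⟩
    ∑< N (λ k → ∑< N (λ i → r i * Cnk r (N ∸ i ∸ 1) k))     ≈⟨ ∑<-comm N N (λ k i → r i * Cnk r (N ∸ i ∸ 1) k) ⟩
    ∑< N (λ i → ∑< N (λ k → r i * Cnk r (N ∸ i ∸ 1) k))     ≈⟨ ∑<-cong N (λ i _ → sym (*-distribˡ-∑< (r i) N (Cnk r (N ∸ i ∸ 1)))) ⟩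
    ∑< N (λ i → r i * ∑< N (Cnk r (N ∸ i ∸ 1)))             ≈⟨ ∑<-cong N (λ i _ → *-congˡ (∑<Cnk≈Cn (row<N i))) ⟩
    ∑< N (λ i → r i * Cn r (N ∸ i ∸ 1))                     ∎
    where
    N = suc n

    row<N : ∀ i → N ∸ i ∸ 1 < N
    row<N i = s≤s (∸-monoˡ-≤ 1 (m∸n≤m N i))

mainTheorem1 : {c ℓ : Level} (R : CommutativeRing c ℓ) (r : ℕ → CommutativeRing.Carrier R) (n : ℕ) →
    let open CommutativeRing R in let open CNumbers R in
    Cn r (suc n) ≈ ∑< (suc n) (λ i → r i * Cn r (suc n ∸ i ∸ 1))
mainTheorem1 R r = CnkProperties.Cn-recurrence R r
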